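{- Let $p$ be a prime, $\ell\ge1$ an integer, $e_1,e_2,\dots\in\mathbb{Z}$ and $E(x)=1+\sum_{j\ge1}e_jx^j$. For $n\ge1$ let \[T_n(x)=1+\sum_{k=1}^\infty\frac{n+1-k}{k!}\bigg(\sum_{j=1}^k(-1)^j\frac{(n+j)!}{(n+1)!}B_{k,j}(1!\,e_1,2!\,e_2,\dots)\bigg)x^k,\] and let $T_0(x)=E(x)T_1(x)$ and $T_{ -1}(x)=E(x)^2T_1(x)$. For $n\ge1$ let \[t_n=1+\sum_{k=1}^n p^{\ell k}\frac{n+1-k}{k!}\sum_{j=1}^k(-1)^j\frac{(n+j)!}{(n+1)!}B_{k,j}(1!\,e_1,2!\,e_2,\dots),\] and $t_0=t_{ -1}=1$. Then for every integer $\nu\ge-1$, the $p$-adic integers $T_\nu(p^\ell)$ satisfy \[T_\nu(p^\ell)-t_\nu\equiv0\pmod{p^{\ell(\nu+2)}}.\]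
   Context: Each $T_\nu(x)$ lies in $\mathbb{Z}[[x]]$, so $T_\nu(p^\ell)$ converges in the $p$-adic integers $\mathbb{Z}_p$. For a sequence $x_1,x_2,\dots$, the partial Bell polynomial is $B_{n,k}(x_1,x_2,\dots)=\sum \frac{n!}{i_1!i_2!\cdots}\left(\frac{x_1}{1!}\right)^{i_1}\left(\frac{x_2}{2!}\right)^{i_2}\cdots$, the sum over all sequences $(i_1,i_2,\dots)$ of nonnegative integers with $i_1+i_2+\cdots=k$ and $i_1+2i_2+\cdots=n$. -}

module Defs where

open import Data.Nat as ℕ using (ℕ; zero; suc; _!; _≤ᵇ_)
open import Data.Nat.Properties using (_!≢0)
open import Relation.Binary.PropositionalEquality using (_≡_)
open import Data.Product using (∃)
open import Data.Integer as ℤ using (ℤ; +_; -[1+_]; +[1+_])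
open import Data.Rational as ℚ using (ℚ; 0ℚ; 1ℚ; _+_; _*_; _-_; -_)
open import Data.Bool using (if_then_else_)

_^ℚ_ : ℚ → ℕ → ℚ
x ^ℚ zero = 1ℚ
x ^ℚ suc n = x * (x ^ℚ n)

Σ≤ : ℕ → (ℕ → ℚ) → ℚ
Σ≤ zero f = f 0
Σ≤ (suc n) f = Σ≤ n f + f (suc n)

Σ1 : ℕ → (ℕ → ℚ) → ℚ
Σ1 zero f = 0ℚ
Σ1 (suc n) f = Σ1 n f + f (suc n)

invFact : ℕ → ℚ
invFact k = ℚ._/_ (+ 1) (k !) {{k !≢0}}

factRatio : ℕ → ℕ → ℚ
factRatio a b = ℚ._/_ (+ (a !)) (b !) {{b !≢0}}

sgn : ℕ → ℚ
sgn j = (- 1ℚ) ^ℚ j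

-- bellAux x m n k = Σ over (i_1,…,i_m) ∈ ℕ^m with Σ i_r = k and Σ r·i_r = n
--   of  Π_{r=1}^{m} (1 / i_r!) (x_r / r!)^{i_r}.
bellAux : (ℕ → ℚ) → ℕ → ℕ → ℕ → ℚ
bellAux x zero zero zero = 1ℚ
bellAux x zero _ _ = 0ℚ
bellAux x (suc m) n k =
  Σ≤ k (λ i → if (i ℕ.* suc m) ≤ᵇ n
                then invFact i * ((x (suc m) * invFact (suc m)) ^ℚ i)
                       * bellAux x m (n ℕ.∸ i ℕ.* suc m) (k ℕ.∸ i)
                else 0ℚ)

-- Partial Bell polynomial B_{n,k}(x_1, x_2, …) (x r stands for x_r, r ≥ 1);
-- parts larger than n cannot occur, so sequences (i_1,…,i_n) suffice.
bell : ℕ → ℕ → (ℕ → ℚ) → ℚ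
bell n k x = ℚ._/_ (+ (n !)) 1 * bellAux x n n k

-- The sequence e_1, e_2, … is given as e : ℕ → ℤ, with e j = e_j for j ≥ 1
-- (e 0 is ignored).  Coefficients of E(x) = 1 + Σ_{j≥1} e_j x^j :
Ecoef : (ℕ → ℤ) → ℕ → ℚ
Ecoef e zero = 1ℚ
Ecoef e (suc j) = ℚ._/_ (e (suc j)) 1

fe : (ℕ → ℤ) → ℕ → ℚ
fe e m = ℚ._/_ (+ (m !)) 1 * ℚ._/_ (e m) 1

coefT : (ℕ → ℤ) → ℕ → ℕ → ℚ
coefT e n k =
  (ℚ._/_ ((+ (n ℕ.+ 1)) ℤ.- (+ k)) 1 * invFact k)
  * Σ1 k (λ j → sgn j * factRatio (n ℕ.+ j) (n ℕ.+ 1) * bell k j (fe e))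

T₊ : (ℕ → ℤ) → ℕ → ℕ → ℚ
T₊ e n zero = 1ℚ
T₊ e n (suc k) = coefT e n (suc k)

conv : (ℕ → ℚ) → (ℕ → ℚ) → ℕ → ℚ
conv a b k = Σ≤ k (λ i → a i * b (k ℕ.∸ i))

-- coefficients of T_ν(x) for ν ≥ -1 (value for ν < -1 irrelevant, set to 0):
--   T_n for n ≥ 1, T_0 = E·T_1, T_{-1} = E²·T_1.
Tcoef : (ℕ → ℤ) → ℤ → ℕ → ℚ
Tcoef e +[1+ n ] = T₊ e (suc n)
Tcoef e (+ zero) = conv (Ecoef e) (T₊ e 1)
Tcoef e -[1+ zero ] = conv (Ecoef e) (conv (Ecoef e) (T₊ e 1))
Tcoef e -[1+ suc _ ] = λ _ → 0ℚ

tval : (p ℓ : ℕ) → (ℕ → ℤ) → ℤ → ℚ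
tval p ℓ e +[1+ n ] =
  1ℚ + Σ1 (suc n) (λ k → (ℚ._/_ (+ (p ℕ.^ (ℓ ℕ.* k))) 1) * coefT e (suc n) k)
tval p ℓ e (+ zero) = 1ℚ
tval p ℓ e -[1+ _ ] = 1ℚ

partialEval : (p ℓ : ℕ) → (ℕ → ℚ) → ℕ → ℚ
partialEval p ℓ c K = Σ≤ K (λ k → c k * ℚ._/_ (+ (p ℕ.^ (ℓ ℕ.* k))) 1)

_≡_[modℤ_] : ℚ → ℚ → ℕ → Set
a ≡ b [modℤ m ] = ∃ λ (z : ℤ) → a - b ≡ ℚ._/_ (+ m ℤ.* z) 1

-- Every coefficient of every T_ν is an integer, and t_ν is exactly the truncation of T_ν(p^ℓ) at degree
-- ν + 1; so T_ν(p^ℓ) - t_ν is a sum of integer multiples of p^{ℓk} with k ≥ ν + 2, for any p and ℓ.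
--
-- Integrality: the factor k! of B_{k,j}(1! e₁, 2! e₂, …) cancels the 1/k!, leaving the coefficient of x^k
-- in T_n as Σ_j (-1)^j Σ_i ∏_r e_r^{i_r} (n+1-k) (n+j)! / ((n+1)! ∏_r i_r!), where i runs over the
-- (i_1, i_2, …) with Σ i_r = j and Σ r i_r = k. Writing n+1-k = (n+1) - Σ r i_r splits each weight into
-- multinomial coefficients. Truncation: for n ≥ 1 the coefficient of x^{n+1} in T_n has the factor
-- n+1-k = 0, the coefficient of x in E·T₁ is e₁ - e₁ = 0, and the constant term of E²·T₁ is 1.

module Submission where

open import Defs

module _ where
  open import Data.Nat as ℕ
    using (ℕ; zero; suc; _∸_; _≤_; _^_; _!; _≤ᵇ_; _≤′_; ≤′-refl; ≤′-step; s≤s; NonZero)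
  import Data.Nat.Properties as ℕP
  open import Data.Nat.Combinatorics using (k![n∸k]!∣n!)
  open import Data.Nat.Divisibility using (_∣_; divides)
  open import Data.Nat.Tactic.RingSolver as ℕ-Solver using ()
  open import Data.Integer as ℤ using (ℤ; +_; +[1+_]; -[1+_])
  import Data.Integer.Properties as ℤP
  open import Data.Integer.Tactic.RingSolver as ℤ-Solver using ()
  open import Data.Rational as ℚ using (ℚ; 0ℚ; 1ℚ; _+_; _*_; _-_; -_; _/_; toℚᵘ)
  import Data.Rational.Properties as ℚP
  open import Data.Rational.Unnormalised as ℚᵘ using (mkℚᵘ; *≡*) renaming (_≃_ to _≃ᵘ_)
  import Data.Rational.Unnormalised.Properties as ℚᵘP
  open import Data.Bool using (T; true; false; if_then_else_)
  open import Data.Unit using (tt)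
  open import Data.Product using (∃; _,_; map₂)
  open import Level using (0ℓ)
  open import Relation.Binary.PropositionalEquality
  open import Relation.Nullary.Decidable using (dec⇒maybe)
  open import Tactic.RingSolver using (solve-∀)
  open import Tactic.RingSolver.Core.AlmostCommutativeRing using (AlmostCommutativeRing; fromCommutativeRing)

  ℚ-ring : AlmostCommutativeRing 0ℓ 0ℓ
  ℚ-ring = fromCommutativeRing ℚP.+-*-commutativeRing (λ q → dec⇒maybe (0ℚ ℚP.≟ q))

  fromℤ : ℤ → ℚ
  fromℤ z = z / 1

  toℚᵘ-/ : ∀ z d .{{_ : NonZero d}} → toℚᵘ (z / d) ≃ᵘ z ℚᵘ./ d
  toℚᵘ-/ z (suc d) = ℚP.toℚᵘ-fromℚᵘ (mkℚᵘ z d)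

  /-cross : ∀ z w b d .{{_ : NonZero b}} .{{_ : NonZero d}} →
            z ℤ.* + d ≡ w ℤ.* + b → z / b ≡ w / d
  /-cross z w b@(suc _) d@(suc _) eq = ℚP.toℚᵘ-injective
    (ℚᵘP.≃-trans (toℚᵘ-/ z b) (ℚᵘP.≃-trans (*≡* eq) (ℚᵘP.≃-sym (toℚᵘ-/ w d))))

  /-* : ∀ z w b d .{{_ : NonZero b}} .{{_ : NonZero d}} →
        (z / b) * (w / d) ≡ _/_ (z ℤ.* w) (b ℕ.* d) {{ℕP.m*n≢0 b d}}
  /-* z w b@(suc _) d@(suc _) = ℚP.toℚᵘ-injective (begin
    toℚᵘ ((z / b) * (w / d))          ≈⟨ ℚP.toℚᵘ-homo-* (z / b) (w / d) ⟩
    toℚᵘ (z / b) ℚᵘ.* toℚᵘ (w / d)    ≈⟨ ℚᵘP.*-cong (toℚᵘ-/ z b) (toℚᵘ-/ w d) ⟩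
    (z ℚᵘ./ b) ℚᵘ.* (w ℚᵘ./ d)        ≈⟨ toℚᵘ-/ (z ℤ.* w) (b ℕ.* d) ⟨
    toℚᵘ ((z ℤ.* w) / (b ℕ.* d))      ∎)
    where open ℚᵘP.≃-Reasoning

  fromℤ-* : ∀ a b → fromℤ (a ℤ.* b) ≡ fromℤ a * fromℤ b
  fromℤ-* a b = sym (/-* a b 1 1)

  fromℤ-+ : ∀ a b → fromℤ (a ℤ.+ b) ≡ fromℤ a + fromℤ b
  fromℤ-+ a b = ℚP.toℚᵘ-injective (begin
    toℚᵘ (fromℤ (a ℤ.+ b))               ≈⟨ toℚᵘ-/ (a ℤ.+ b) 1 ⟩
    (a ℤ.+ b) ℚᵘ./ 1                     ≈⟨ *≡* (over-1 a b) ⟩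
    (a ℚᵘ./ 1) ℚᵘ.+ (b ℚᵘ./ 1)           ≈⟨ ℚᵘP.+-cong (toℚᵘ-/ a 1) (toℚᵘ-/ b 1) ⟨
    toℚᵘ (fromℤ a) ℚᵘ.+ toℚᵘ (fromℤ b)   ≈⟨ ℚP.toℚᵘ-homo-+ (fromℤ a) (fromℤ b) ⟨
    toℚᵘ (fromℤ a + fromℤ b)             ∎)
    where
    open ℚᵘP.≃-Reasoning
    over-1 : ∀ a b → (a ℤ.+ b) ℤ.* + 1 ≡ (a ℤ.* + 1 ℤ.+ b ℤ.* + 1) ℤ.* + 1
    over-1 = ℤ-Solver.solve-∀

  fromℤ-neg : ∀ a → fromℤ (ℤ.- a) ≡ - fromℤ a
  fromℤ-neg a = ℚP.toℚᵘ-injective (begin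
    toℚᵘ (fromℤ (ℤ.- a))   ≈⟨ toℚᵘ-/ (ℤ.- a) 1 ⟩
    (ℤ.- a) ℚᵘ./ 1         ≈⟨ ℚᵘP.-‿cong (toℚᵘ-/ a 1) ⟨
    ℚᵘ.- toℚᵘ (fromℤ a)    ≈⟨ ℚP.toℚᵘ-homo‿- (fromℤ a) ⟨
    toℚᵘ (- fromℤ a)       ∎)
    where open ℚᵘP.≃-Reasoning

  fromℤ-- : ∀ a b → fromℤ (a ℤ.- b) ≡ fromℤ a - fromℤ b
  fromℤ-- a b = trans (fromℤ-+ a (ℤ.- b)) (cong (_+_ (fromℤ a)) (fromℤ-neg b))

  ℕ/-cross : ∀ x y b d .{{_ : NonZero b}} .{{_ : NonZero d}} →
             x ℕ.* d ≡ y ℕ.* b → + x / b ≡ + y / d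
  ℕ/-cross x y b d eq = /-cross (+ x) (+ y) b d (begin
    + x ℤ.* + d   ≡⟨ ℤP.pos-* x d ⟨
    + (x ℕ.* d)   ≡⟨ cong +_ eq ⟩
    + (y ℕ.* b)   ≡⟨ ℤP.pos-* y b ⟩
    + y ℤ.* + b   ∎)
    where open ≡-Reasoning

  ℕ/-* : ∀ x y b d .{{_ : NonZero b}} .{{_ : NonZero d}} →
         (+ x / b) * (+ y / d) ≡ _/_ (+ (x ℕ.* y)) (b ℕ.* d) {{ℕP.m*n≢0 b d}}
  ℕ/-* x y b d = trans (/-* (+ x) (+ y) b d)
    (cong (λ z → _/_ z (b ℕ.* d) {{ℕP.m*n≢0 b d}}) (sym (ℤP.pos-* x y)))

  ℕ/-*-≡ : ∀ x y z b d q .{{_ : NonZero b}} .{{_ : NonZero d}} .{{_ : NonZero q}} →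
           x ℕ.* y ℕ.* q ≡ z ℕ.* (b ℕ.* d) → (+ x / b) * (+ y / d) ≡ + z / q
  ℕ/-*-≡ x y z b d q eq =
    trans (ℕ/-* x y b d) (ℕ/-cross (x ℕ.* y) z (b ℕ.* d) q {{ℕP.m*n≢0 b d}} eq)

  Integral : ℚ → Set
  Integral q = ∃ λ z → q ≡ fromℤ z

  integral-fromℤ : ∀ z → Integral (fromℤ z)
  integral-fromℤ z = z , refl

  integral-0 : Integral 0ℚ
  integral-0 = integral-fromℤ (+ 0)

  integral-1 : Integral 1ℚ
  integral-1 = integral-fromℤ (+ 1)

  integral-+ : ∀ {a b} → Integral a → Integral b → Integral (a + b)
  integral-+ (z , refl) (w , refl) = z ℤ.+ w , sym (fromℤ-+ z w)

  integral-* : ∀ {a b} → Integral a → Integral b → Integral (a * b)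
  integral-* (z , refl) (w , refl) = z ℤ.* w , sym (fromℤ-* z w)

  integral-neg : ∀ {a} → Integral a → Integral (- a)
  integral-neg (z , refl) = ℤ.- z , sym (fromℤ-neg z)

  integral-- : ∀ {a b} → Integral a → Integral b → Integral (a - b)
  integral-- p q = integral-+ p (integral-neg q)

  integral-*-zeroʳ : ∀ q → Integral (q * 0ℚ)
  integral-*-zeroʳ q = subst Integral (sym (ℚP.*-zeroʳ q)) integral-0

  integral-^ : ∀ {a} n → Integral a → Integral (a ^ℚ n)
  integral-^ zero    _ = integral-1
  integral-^ (suc n) p = integral-* p (integral-^ n p)

  integral-Σ≤ : ∀ n f → (∀ i → i ≤ n → Integral (f i)) → Integral (Σ≤ n f)
  integral-Σ≤ zero    f p = p 0 ℕ.z≤n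
  integral-Σ≤ (suc n) f p =
    integral-+ (integral-Σ≤ n f (λ i i≤n → p i (ℕP.m≤n⇒m≤1+n i≤n))) (p (suc n) ℕP.≤-refl)

  integral-Σ1 : ∀ n f → (∀ i → Integral (f (suc i))) → Integral (Σ1 n f)
  integral-Σ1 zero    f p = integral-0
  integral-Σ1 (suc n) f p = integral-+ (integral-Σ1 n f p) (p n)

  integral-*-rescale : ∀ f g f′ y b → (∃ λ c → f * g ≡ fromℤ c * f′) →
                       Integral y → Integral (f′ * b) → Integral (f * (g * y * b))
  integral-*-rescale f g f′ y b (c , fg≡cf′) integral-y integral-f′b =
    subst Integral (sym (begin
      f * (g * y * b)           ≡⟨ regroup f g y b ⟩
      f * g * (y * b)           ≡⟨ cong (_* (y * b)) fg≡cf′ ⟩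
      fromℤ c * f′ * (y * b)    ≡⟨ interchange (fromℤ c) f′ y b ⟩
      fromℤ c * y * (f′ * b)    ∎))
      (integral-* (integral-* (integral-fromℤ c) integral-y) integral-f′b)
    where
    open ≡-Reasoning
    regroup : ∀ f g y b → f * (g * y * b) ≡ f * g * (y * b)
    regroup = solve-∀ ℚ-ring
    interchange : ∀ c f y b → c * f * (y * b) ≡ c * y * (f * b)
    interchange = solve-∀ ℚ-ring

  integral-*-difference : ∀ f w u v g y b → w ≡ u - v →
                          Integral (f * (g * y * (u * b))) → Integral (f * (g * v * y * b)) →
                          Integral (f * w * (g * y * b))
  integral-*-difference f w u v g y b refl integral-u integral-v =
    subst Integral (sym (distribute f u v g y b)) (integral-- integral-u integral-v)
    where
    distribute : ∀ f u v g y b → f * (u - v) * (g * y * b) ≡ f * (g * y * (u * b)) - f * (g * v * y * b)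
    distribute = solve-∀ ℚ-ring

  *-distribˡ-Σ≤ : ∀ c n f → c * Σ≤ n f ≡ Σ≤ n (λ i → c * f i)
  *-distribˡ-Σ≤ c zero    f = refl
  *-distribˡ-Σ≤ c (suc n) f =
    trans (ℚP.*-distribˡ-+ c (Σ≤ n f) (f (suc n))) (cong (_+ c * f (suc n)) (*-distribˡ-Σ≤ c n f))

  *-distribˡ-Σ1 : ∀ c n f → c * Σ1 n f ≡ Σ1 n (λ i → c * f i)
  *-distribˡ-Σ1 c zero    f = ℚP.*-zeroʳ c
  *-distribˡ-Σ1 c (suc n) f =
    trans (ℚP.*-distribˡ-+ c (Σ1 n f) (f (suc n))) (cong (_+ c * f (suc n)) (*-distribˡ-Σ1 c n f))

  Σ1-cong : ∀ n {f g} → (∀ i → f (suc i) ≡ g (suc i)) → Σ1 n f ≡ Σ1 n g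
  Σ1-cong zero    eq = refl
  Σ1-cong (suc n) eq = cong₂ _+_ (Σ1-cong n eq) (eq n)

  Σ≤-split : ∀ n f → Σ≤ n f ≡ f 0 + Σ1 n f
  Σ≤-split zero    f = sym (ℚP.+-identityʳ (f 0))
  Σ≤-split (suc n) f =
    trans (cong (_+ f (suc n)) (Σ≤-split n f)) (ℚP.+-assoc (f 0) (Σ1 n f) (f (suc n)))

  invFact-*-! : ∀ k → invFact k * fromℤ (+ (k !)) ≡ 1ℚ
  invFact-*-! k = ℕ/-*-≡ 1 (k !) 1 (k !) 1 1 (ℕP.*-assoc 1 (k !) 1)
    where instance _ = k ℕP.!≢0

  invFact-suc : ∀ i → invFact (suc i) * fromℤ (+ suc i) ≡ invFact i
  invFact-suc i = ℕ/-*-≡ 1 (suc i) 1 (suc i !) 1 (i !) (rearrange (suc i) (i !))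
    where
    instance
      _ = suc i ℕP.!≢0
      _ = i ℕP.!≢0
    rearrange : ∀ s f → 1 ℕ.* s ℕ.* f ≡ 1 ℕ.* (s ℕ.* f ℕ.* 1)
    rearrange = ℕ-Solver.solve-∀

  factRatio-self : ∀ n → factRatio n n ≡ 1ℚ
  factRatio-self n =
    ℕ/-cross (n !) 1 (n !) 1 (trans (ℕP.*-identityʳ (n !)) (sym (ℕP.*-identityˡ (n !))))
    where instance _ = n ℕP.!≢0

  factRatio-suc : ∀ n → factRatio n (suc n) * fromℤ (+ suc n) ≡ 1ℚ
  factRatio-suc n = ℕ/-*-≡ (n !) (suc n) 1 (suc n !) 1 1 (rearrange (n !) n)
    where
    instance _ = suc n ℕP.!≢0
    rearrange : ∀ f n → f ℕ.* suc n ℕ.* 1 ≡ 1 ℕ.* ((f ℕ.+ n ℕ.* f) ℕ.* 1)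
    rearrange = ℕ-Solver.solve-∀

  factRatio-*-invFact : ∀ {n i} b → i ≤ n →
                        ∃ λ c → factRatio n b * invFact i ≡ fromℤ c * factRatio (n ∸ i) b
  factRatio-*-invFact {n} {i} b i≤n = quotient (k![n∸k]!∣n! i≤n)
    where
    instance
      _ = b ℕP.!≢0
      _ = i ℕP.!≢0
      _ = ℕP.m*n≢0 1 (b !)
    rearrange : ∀ c f g b → c ℕ.* (f ℕ.* g) ℕ.* 1 ℕ.* (1 ℕ.* b) ≡ c ℕ.* g ℕ.* (b ℕ.* f)
    rearrange = ℕ-Solver.solve-∀
    quotient : i ! ℕ.* (n ∸ i) ! ∣ n ! →
               ∃ λ c → factRatio n b * invFact i ≡ fromℤ c * factRatio (n ∸ i) b
    quotient (divides c n!≡c*i!*[n∸i]!) =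
      + c , trans (ℕ/-*-≡ (n !) 1 (c ℕ.* (n ∸ i) !) (b !) (i !) (1 ℕ.* b !) cross)
                  (sym (ℕ/-* c ((n ∸ i) !) 1 (b !)))
      where
      cross : n ! ℕ.* 1 ℕ.* (1 ℕ.* b !) ≡ c ℕ.* (n ∸ i) ! ℕ.* (b ! ℕ.* i !)
      cross rewrite n!≡c*i!*[n∸i]! = rearrange c (i !) ((n ∸ i) !) (b !)

  factRatio-+-*-invFact :
    ∀ a b {i j} → i ≤ j →
    ∃ λ c → factRatio (a ℕ.+ j) b * invFact i ≡ fromℤ c * factRatio (a ℕ.+ (j ∸ i)) b
  factRatio-+-*-invFact a b {i} {j} i≤j =
    map₂ (λ {c} eq → trans eq (cong (λ t → fromℤ c * factRatio t b) (ℕP.+-∸-assoc a i≤j)))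
         (factRatio-*-invFact {a ℕ.+ j} {i} b (ℕP.≤-trans i≤j (ℕP.m≤n+m j a)))

  fe-*-invFact : ∀ e r → fe e r * invFact r ≡ fromℤ (e r)
  fe-*-invFact e r = begin
    fromℤ (+ (r !)) * fromℤ (e r) * invFact r
      ≡⟨ rearrange (fromℤ (+ (r !))) (fromℤ (e r)) (invFact r) ⟩
    fromℤ (e r) * (invFact r * fromℤ (+ (r !)))
      ≡⟨ cong (_*_ (fromℤ (e r))) (invFact-*-! r) ⟩
    fromℤ (e r) * 1ℚ
      ≡⟨ ℚP.*-identityʳ (fromℤ (e r)) ⟩
    fromℤ (e r)
      ∎
    where
    open ≡-Reasoning
    rearrange : ∀ f z i → f * z * i ≡ z * (i * f)
    rearrange = solve-∀ ℚ-ring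

  a+[j∸i]≡a+1+[j∸1+i] : ∀ a {i j} → suc i ≤ j → a ℕ.+ (j ∸ i) ≡ a ℕ.+ 1 ℕ.+ (j ∸ suc i)
  a+[j∸i]≡a+1+[j∸1+i] a {i} {j} 1+i≤j = begin
    a ℕ.+ (j ∸ i)            ≡⟨ cong (a ℕ.+_) (ℕP.+-∸-assoc 1 1+i≤j) ⟩
    a ℕ.+ suc (j ∸ suc i)    ≡⟨ ℕP.+-assoc a 1 (j ∸ suc i) ⟨
    a ℕ.+ 1 ℕ.+ (j ∸ suc i)  ∎
    where open ≡-Reasoning

  m-n≡m-[n∸v]-v : ∀ m {v n} → v ≤ n → m ℤ.- + n ≡ m ℤ.- + (n ∸ v) ℤ.- + v
  m-n≡m-[n∸v]-v m {v} {n} v≤n = begin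
    m ℤ.- + n                    ≡⟨ cong (λ t → m ℤ.- + t) (ℕP.m∸n+n≡m v≤n) ⟨
    m ℤ.- + (n ∸ v ℕ.+ v)        ≡⟨ cong (ℤ._-_ m) (ℤP.pos-+ (n ∸ v) v) ⟩
    m ℤ.- (+ (n ∸ v) ℤ.+ + v)    ≡⟨ sub-+ m (+ (n ∸ v)) (+ v) ⟩
    m ℤ.- + (n ∸ v) ℤ.- + v      ∎
    where
    open ≡-Reasoning
    sub-+ : ∀ m u v → m ℤ.- (u ℤ.+ v) ≡ m ℤ.- u ℤ.- v
    sub-+ = ℤ-Solver.solve-∀

  risingBell : (ℕ → ℚ) → ℕ → ℕ → ℕ → ℕ → ℚ
  risingBell x a m n j = factRatio (a ℕ.+ j) a * bellAux x m n j

  coefBell : (ℕ → ℚ) → ℕ → ℕ → ℕ → ℕ → ℚ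
  coefBell x a m n j = factRatio (a ℕ.+ j) (a ℕ.+ 1) * fromℤ (+ (a ℕ.+ 1) ℤ.- + n) * bellAux x m n j

  module _ (x : ℕ → ℚ) (integral-x/r! : ∀ r → Integral (x (suc r) * invFact (suc r))) where

    private
      y : ℕ → ℚ
      y m = x (suc m) * invFact (suc m)

    integral-*-bellAux-suc : ∀ w m n j →
      (∀ i → i ≤ j → i ℕ.* suc m ≤ n →
         Integral (w * (invFact i * y m ^ℚ i * bellAux x m (n ∸ i ℕ.* suc m) (j ∸ i)))) →
      Integral (w * bellAux x (suc m) n j)
    integral-*-bellAux-suc w m n j integral-term =
      subst Integral (sym (*-distribˡ-Σ≤ w j _)) (integral-Σ≤ j _ term)
      where
      term : ∀ i → i ≤ j →
             Integral (w * (if i ℕ.* suc m ≤ᵇ n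
                            then invFact i * y m ^ℚ i * bellAux x m (n ∸ i ℕ.* suc m) (j ∸ i)
                            else 0ℚ))
      term i i≤j with i ℕ.* suc m ≤ᵇ n in v≤ᵇn
      ... | false = integral-*-zeroʳ w
      ... | true  = integral-term i i≤j (ℕP.≤ᵇ⇒≤ (i ℕ.* suc m) n (subst T (sym v≤ᵇn) tt))

    risingBell-integral : ∀ a m n j → Integral (risingBell x a m n j)
    risingBell-integral a zero zero zero = subst Integral (sym (begin
      factRatio (a ℕ.+ 0) a * 1ℚ   ≡⟨ ℚP.*-identityʳ (factRatio (a ℕ.+ 0) a) ⟩
      factRatio (a ℕ.+ 0) a        ≡⟨ cong (λ t → factRatio t a) (ℕP.+-identityʳ a) ⟩
      factRatio a a                ≡⟨ factRatio-self a ⟩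
      1ℚ                           ∎)) integral-1
      where open ≡-Reasoning
    risingBell-integral a zero zero    (suc j) = integral-*-zeroʳ (factRatio (a ℕ.+ suc j) a)
    risingBell-integral a zero (suc n) j       = integral-*-zeroʳ (factRatio (a ℕ.+ j) a)
    risingBell-integral a (suc m) n j = integral-*-bellAux-suc (factRatio (a ℕ.+ j) a) m n j λ i i≤j _ →
      integral-*-rescale (factRatio (a ℕ.+ j) a) (invFact i) (factRatio (a ℕ.+ (j ∸ i)) a) (y m ^ℚ i)
        (bellAux x m (n ∸ i ℕ.* suc m) (j ∸ i))
        (factRatio-+-*-invFact a a i≤j) (integral-^ i (integral-x/r! m))
        (risingBell-integral a m (n ∸ i ℕ.* suc m) (j ∸ i))

    coefBell-integral : ∀ a m n j → Integral (coefBell x a m n j)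
    coefBell-integral a zero zero zero = subst Integral (sym (begin
      factRatio (a ℕ.+ 0) (a ℕ.+ 1) * fromℤ (+ (a ℕ.+ 1) ℤ.- + 0) * 1ℚ
        ≡⟨ ℚP.*-identityʳ (factRatio (a ℕ.+ 0) (a ℕ.+ 1) * fromℤ (+ (a ℕ.+ 1) ℤ.- + 0)) ⟩
      factRatio (a ℕ.+ 0) (a ℕ.+ 1) * fromℤ (+ (a ℕ.+ 1) ℤ.- + 0)
        ≡⟨ cong (λ t → factRatio (a ℕ.+ 0) (a ℕ.+ 1) * fromℤ t) (ℤP.+-identityʳ (+ (a ℕ.+ 1))) ⟩
      factRatio (a ℕ.+ 0) (a ℕ.+ 1) * fromℤ (+ (a ℕ.+ 1))
        ≡⟨ cong₂ (λ s t → factRatio s t * fromℤ (+ t)) (ℕP.+-identityʳ a) (ℕP.+-comm a 1) ⟩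
      factRatio a (suc a) * fromℤ (+ suc a)
        ≡⟨ factRatio-suc a ⟩
      1ℚ ∎)) integral-1
      where open ≡-Reasoning
    coefBell-integral a zero zero (suc j) =
      integral-*-zeroʳ (factRatio (a ℕ.+ suc j) (a ℕ.+ 1) * fromℤ (+ (a ℕ.+ 1) ℤ.- + 0))
    coefBell-integral a zero (suc n) j =
      integral-*-zeroʳ (factRatio (a ℕ.+ j) (a ℕ.+ 1) * fromℤ (+ (a ℕ.+ 1) ℤ.- + suc n))
    -- Using the part m+1 exactly i times, a+1-n = (a+1-n′) - i(m+1) with n′ = n - i(m+1). The first term
    -- gives again a coefBell; in the second, i/i! = 1/(i-1)! turns (a+j)!/((a+1)! i!) into an integer
    -- multiple of (a+1+(j-i))!/(a+1)!, leaving a risingBell from a+1.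
    coefBell-integral a (suc m) n j = integral-*-bellAux-suc (F * W n) m n j λ i i≤j i[1+m]≤n →
      integral-*-difference F (W n) (W (n′ i)) (V i) (invFact i) (Y i) (B i) (split-offset i[1+m]≤n)
        (integral-*-rescale F (invFact i) (F′ i) (Y i) (W (n′ i) * B i)
           (factRatio-+-*-invFact a (a ℕ.+ 1) i≤j) (integral-^ i (integral-x/r! m))
           (subst Integral (ℚP.*-assoc (F′ i) (W (n′ i)) (B i))
                  (coefBell-integral a m (n′ i) (j ∸ i))))
        (shifted i i≤j)
      where
      F : ℚ
      F = factRatio (a ℕ.+ j) (a ℕ.+ 1)
      F′ : ℕ → ℚ
      F′ i = factRatio (a ℕ.+ (j ∸ i)) (a ℕ.+ 1)
      W : ℕ → ℚ
      W k = fromℤ (+ (a ℕ.+ 1) ℤ.- + k)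
      n′ : ℕ → ℕ
      n′ i = n ∸ i ℕ.* suc m
      V : ℕ → ℚ
      V i = fromℤ (+ (i ℕ.* suc m))
      Y : ℕ → ℚ
      Y i = y m ^ℚ i
      B : ℕ → ℚ
      B i = bellAux x m (n′ i) (j ∸ i)

      split-offset : ∀ {v} → v ≤ n → W n ≡ W (n ∸ v) - fromℤ (+ v)
      split-offset {v} v≤n =
        trans (cong fromℤ (m-n≡m-[n∸v]-v (+ (a ℕ.+ 1)) v≤n))
              (fromℤ-- (+ (a ℕ.+ 1) ℤ.- + (n ∸ v)) (+ v))

      shifted : ∀ i → i ≤ j → Integral (F * (invFact i * V i * Y i * B i))
      shifted zero _ = subst Integral (sym (vanish F (Y 0) (B 0))) integral-0
        where
        vanish : ∀ f y b → f * (1ℚ * 0ℚ * y * b) ≡ 0ℚ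
        vanish = solve-∀ ℚ-ring
      shifted (suc i) 1+i≤j =
        integral-*-rescale F (invFact (suc i) * V (suc i)) F″ (Y (suc i)) (B (suc i))
          (rescale (factRatio-+-*-invFact a (a ℕ.+ 1) (ℕP.<⇒≤ 1+i≤j)))
          (integral-^ (suc i) (integral-x/r! m))
          (risingBell-integral (a ℕ.+ 1) m (n′ (suc i)) (j ∸ suc i))
        where
        open ≡-Reasoning
        M = fromℤ (+ suc m)
        F″ = factRatio (a ℕ.+ 1 ℕ.+ (j ∸ suc i)) (a ℕ.+ 1)
        regroup : ∀ f g s m → f * (g * (s * m)) ≡ f * (g * s) * m
        regroup = solve-∀ ℚ-ring
        swap : ∀ c f m → c * f * m ≡ c * m * f
        swap = solve-∀ ℚ-ring
        rescale : (∃ λ c → F * invFact i ≡ fromℤ c * F′ i) →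
                  ∃ λ c → F * (invFact (suc i) * V (suc i)) ≡ fromℤ c * F″
        rescale (c , F/i!≡cF′) = c ℤ.* + suc m , (begin
          F * (invFact (suc i) * V (suc i))
            ≡⟨ cong (λ t → F * (invFact (suc i) * t)) (fromℤ-* (+ suc i) (+ suc m)) ⟩
          F * (invFact (suc i) * (fromℤ (+ suc i) * M))
            ≡⟨ regroup F (invFact (suc i)) (fromℤ (+ suc i)) M ⟩
          F * (invFact (suc i) * fromℤ (+ suc i)) * M
            ≡⟨ cong (λ t → F * t * M) (invFact-suc i) ⟩
          F * invFact i * M
            ≡⟨ cong (_* M) F/i!≡cF′ ⟩
          fromℤ c * F′ i * M
            ≡⟨ cong (λ t → fromℤ c * factRatio t (a ℕ.+ 1) * M) (a+[j∸i]≡a+1+[j∸1+i] a 1+i≤j) ⟩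
          fromℤ c * F″ * M
            ≡⟨ swap (fromℤ c) F″ M ⟩
          fromℤ c * M * F″
            ≡⟨ cong (_* F″) (fromℤ-* c (+ suc m)) ⟨
          fromℤ (c ℤ.* + suc m) * F″
            ∎)

  integral-sgn : ∀ j → Integral (sgn j)
  integral-sgn zero    = integral-1
  integral-sgn (suc j) = integral-* (integral-neg integral-1) (integral-sgn j)

  integral-fe/r! : ∀ e r → Integral (fe e (suc r) * invFact (suc r))
  integral-fe/r! e r = subst Integral (sym (fe-*-invFact e (suc r))) (integral-fromℤ (e (suc r)))

  coefT≡Σ-coefBell : ∀ e n k → coefT e n k ≡ Σ1 k (λ j → sgn j * coefBell (fe e) n k k j)
  coefT≡Σ-coefBell e n k = trans (*-distribˡ-Σ1 (A * invFact k) k _) (Σ1-cong k (λ j → summand (suc j)))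
    where
    open ≡-Reasoning
    A = fromℤ (+ (n ℕ.+ 1) ℤ.- + k)
    regroup : ∀ a i s f k g → a * i * (s * f * (k * g)) ≡ i * k * (s * (f * a * g))
    regroup = solve-∀ ℚ-ring
    summand : ∀ j → A * invFact k * (sgn j * factRatio (n ℕ.+ j) (n ℕ.+ 1) * bell k j (fe e))
                    ≡ sgn j * coefBell (fe e) n k k j
    summand j = begin
      A * invFact k * (sgn j * F * (fromℤ (+ (k !)) * G))    ≡⟨ regroup A (invFact k) (sgn j) F (fromℤ (+ (k !))) G ⟩
      invFact k * fromℤ (+ (k !)) * (sgn j * (F * A * G))   ≡⟨ cong (_* (sgn j * (F * A * G))) (invFact-*-! k) ⟩
      1ℚ * (sgn j * (F * A * G))                            ≡⟨ ℚP.*-identityˡ (sgn j * (F * A * G)) ⟩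
      sgn j * (F * A * G)                                   ∎
      where
      F = factRatio (n ℕ.+ j) (n ℕ.+ 1)
      G = bellAux (fe e) k k j

  coefT-integral : ∀ e n k → Integral (coefT e n k)
  coefT-integral e n k = subst Integral (sym (coefT≡Σ-coefBell e n k))
    (integral-Σ1 k (λ j → sgn j * coefBell (fe e) n k k j)
      λ j → integral-* (integral-sgn (suc j)) (coefBell-integral (fe e) (integral-fe/r! e) n k k (suc j)))

  T₊-integral : ∀ e n k → Integral (T₊ e n k)
  T₊-integral e n zero    = integral-1
  T₊-integral e n (suc k) = coefT-integral e n (suc k)

  Ecoef-integral : ∀ e k → Integral (Ecoef e k)
  Ecoef-integral e zero    = integral-1
  Ecoef-integral e (suc k) = integral-fromℤ (e (suc k))

  conv-integral : ∀ {a b} → (∀ i → Integral (a i)) → (∀ i → Integral (b i)) →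
                  ∀ k → Integral (conv a b k)
  conv-integral {a} {b} integral-a integral-b k =
    integral-Σ≤ k (λ i → a i * b (k ∸ i)) (λ i _ → integral-* (integral-a i) (integral-b (k ∸ i)))

  Tcoef-integral : ∀ e ν k → Integral (Tcoef e ν k)
  Tcoef-integral e +[1+ n ]       = T₊-integral e (suc n)
  Tcoef-integral e (+ zero)       = conv-integral (Ecoef-integral e) (T₊-integral e 1)
  Tcoef-integral e -[1+ zero ]    =
    conv-integral (Ecoef-integral e) (conv-integral (Ecoef-integral e) (T₊-integral e 1))
  Tcoef-integral e -[1+ suc _ ] _ = integral-0

  coefT-suc-self : ∀ e n → coefT e n (suc n) ≡ 0ℚ
  coefT-suc-self e n = begin
    fromℤ (+ (n ℕ.+ 1) ℤ.- + suc n) * invFact (suc n) * S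
      ≡⟨ cong (λ t → fromℤ t * invFact (suc n) * S) n+1-[1+n]≡0 ⟩
    0ℚ * invFact (suc n) * S
      ≡⟨ vanish (invFact (suc n)) S ⟩
    0ℚ
      ∎
    where
    open ≡-Reasoning
    S = Σ1 (suc n) (λ j → sgn j * factRatio (n ℕ.+ j) (n ℕ.+ 1) * bell (suc n) j (fe e))
    n+1-[1+n]≡0 : + (n ℕ.+ 1) ℤ.- + suc n ≡ + 0
    n+1-[1+n]≡0 = trans (cong (λ t → + t ℤ.- + suc n) (ℕP.+-comm n 1)) (ℤP.+-inverseʳ (+ suc n))
    vanish : ∀ i s → 0ℚ * i * s ≡ 0ℚ
    vanish = solve-∀ ℚ-ring

  coefT-1-1 : ∀ e → coefT e 1 1 ≡ - fromℤ (e 1)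
  coefT-1-1 e = begin
    coefT e 1 1
      ≡⟨ coefT≡Σ-coefBell e 1 1 ⟩
    0ℚ + (- 1ℚ * 1ℚ) * (1ℚ * 1ℚ * (1ℚ * 1ℚ * 0ℚ + 1ℚ * (Y * 1ℚ) * 1ℚ))
      ≡⟨ evaluate Y ⟩
    - Y
      ≡⟨ cong -_ (fe-*-invFact e 1) ⟩
    - fromℤ (e 1)
      ∎
    where
    open ≡-Reasoning
    Y = fe e 1 * invFact 1
    evaluate : ∀ y → 0ℚ + (- 1ℚ * 1ℚ) * (1ℚ * 1ℚ * (1ℚ * 1ℚ * 0ℚ + 1ℚ * (y * 1ℚ) * 1ℚ)) ≡ - y
    evaluate = solve-∀ ℚ-ring

  E·T₁-coef₁≡0 : ∀ e → conv (Ecoef e) (T₊ e 1) 1 ≡ 0ℚ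
  E·T₁-coef₁≡0 e = begin
    1ℚ * coefT e 1 1 + fromℤ (e 1) * 1ℚ     ≡⟨ cong (λ t → 1ℚ * t + fromℤ (e 1) * 1ℚ) (coefT-1-1 e) ⟩
    1ℚ * - fromℤ (e 1) + fromℤ (e 1) * 1ℚ   ≡⟨ cancel (fromℤ (e 1)) ⟩
    0ℚ                                      ∎
    where
    open ≡-Reasoning
    cancel : ∀ y → 1ℚ * - y + y * 1ℚ ≡ 0ℚ
    cancel = solve-∀ ℚ-ring

  modℤ-refl : ∀ a m → a ≡ a [modℤ m ]
  modℤ-refl a m = + 0 , trans (ℚP.+-inverseʳ a) (cong fromℤ (sym (ℤP.*-zeroʳ (+ m))))

  modℤ-trans : ∀ {a b c m} → a ≡ b [modℤ m ] → b ≡ c [modℤ m ] → a ≡ c [modℤ m ]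
  modℤ-trans {a} {b} {c} {m} (z , a-b≡mz) (w , b-c≡mw) = z ℤ.+ w , (begin
    a - c                                   ≡⟨ telescope a b c ⟩
    (a - b) + (b - c)                       ≡⟨ cong₂ _+_ a-b≡mz b-c≡mw ⟩
    fromℤ (+ m ℤ.* z) + fromℤ (+ m ℤ.* w)   ≡⟨ fromℤ-+ (+ m ℤ.* z) (+ m ℤ.* w) ⟨
    fromℤ (+ m ℤ.* z ℤ.+ + m ℤ.* w)         ≡⟨ cong fromℤ (ℤP.*-distribˡ-+ (+ m) z w) ⟨
    fromℤ (+ m ℤ.* (z ℤ.+ w))               ∎)
    where
    open ≡-Reasoning
    telescope : ∀ a b c → a - c ≡ (a - b) + (b - c)
    telescope = solve-∀ ℚ-ring

  +-*-≡-modℤ : ∀ a c m N → Integral c → m ∣ N → (a + c * fromℤ (+ N)) ≡ a [modℤ m ]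
  +-*-≡-modℤ a c m N (z , refl) (divides q refl) = z ℤ.* + q , (begin
    a + fromℤ z * fromℤ (+ (q ℕ.* m)) - a     ≡⟨ cancel a (fromℤ z * fromℤ (+ (q ℕ.* m))) ⟩
    fromℤ z * fromℤ (+ (q ℕ.* m))             ≡⟨ fromℤ-* z (+ (q ℕ.* m)) ⟨
    fromℤ (z ℤ.* + (q ℕ.* m))                 ≡⟨ cong (λ t → fromℤ (z ℤ.* t)) (ℤP.pos-* q m) ⟩
    fromℤ (z ℤ.* (+ q ℤ.* + m))               ≡⟨ cong fromℤ (reorder z (+ q) (+ m)) ⟩
    fromℤ (+ m ℤ.* (z ℤ.* + q))               ∎)
    where
    open ≡-Reasoning
    cancel : ∀ a b → a + b - a ≡ b
    cancel = solve-∀ ℚ-ring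
    reorder : ∀ z q m → z ℤ.* (q ℤ.* m) ≡ m ℤ.* (z ℤ.* q)
    reorder = ℤ-Solver.solve-∀

  ^-monoʳ-∣ : ∀ b {m n} → m ≤ n → b ^ m ∣ b ^ n
  ^-monoʳ-∣ b {m} {n} m≤n = divides (b ^ (n ∸ m)) (begin
    b ^ n                    ≡⟨ cong (b ^_) (ℕP.m∸n+n≡m m≤n) ⟨
    b ^ (n ∸ m ℕ.+ m)        ≡⟨ ℕP.^-distribˡ-+-* b (n ∸ m) m ⟩
    b ^ (n ∸ m) ℕ.* b ^ m    ∎)
    where open ≡-Reasoning

  partialEval-stable : ∀ p ℓ c {r K} → (∀ k → Integral (c k)) → r ≤′ K →
                       partialEval p ℓ c K ≡ partialEval p ℓ c r [modℤ p ^ (ℓ ℕ.* suc r) ]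
  partialEval-stable p ℓ c {r} integral-c ≤′-refl = modℤ-refl (partialEval p ℓ c r) (p ^ (ℓ ℕ.* suc r))
  partialEval-stable p ℓ c {r} {suc K} integral-c (≤′-step r≤K) =
    modℤ-trans {partialEval p ℓ c (suc K)} {partialEval p ℓ c K} {partialEval p ℓ c r} {p ^ (ℓ ℕ.* suc r)}
      (+-*-≡-modℤ (partialEval p ℓ c K) (c (suc K)) (p ^ (ℓ ℕ.* suc r)) (p ^ (ℓ ℕ.* suc K))
                  (integral-c (suc K)) (^-monoʳ-∣ p (ℕP.*-monoʳ-≤ ℓ (s≤s (ℕP.≤′⇒≤ r≤K)))))
      (partialEval-stable p ℓ c integral-c r≤K)

  eventually-≡-modℤ : ∀ p ℓ {c r t d} → (∀ k → Integral (c k)) →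
                      partialEval p ℓ c r ≡ t → suc r ≡ d →
                      ∃ λ K₀ → ∀ K → K₀ ≤ K → partialEval p ℓ c K ≡ t [modℤ p ^ (ℓ ℕ.* d) ]
  eventually-≡-modℤ p ℓ {c} {r} integral-c refl refl =
    r , λ K r≤K → partialEval-stable p ℓ c integral-c (ℕP.≤⇒≤′ r≤K)

  partialEval-0 : ∀ p ℓ c → partialEval p ℓ c 0 ≡ c 0
  partialEval-0 p ℓ c =
    trans (cong (λ t → c 0 * fromℤ (+ p ^ t)) (ℕP.*-zeroʳ ℓ)) (ℚP.*-identityʳ (c 0))

  partialEval-vanishing : ∀ p ℓ c K → c (suc K) ≡ 0ℚ →
                          partialEval p ℓ c (suc K) ≡ partialEval p ℓ c K
  partialEval-vanishing p ℓ c K c[1+K]≡0 = begin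
    S + c (suc K) * P    ≡⟨ cong (λ t → S + t * P) c[1+K]≡0 ⟩
    S + 0ℚ * P           ≡⟨ cong (_+_ S) (ℚP.*-zeroˡ P) ⟩
    S + 0ℚ               ≡⟨ ℚP.+-identityʳ S ⟩
    S                    ∎
    where
    open ≡-Reasoning
    S = partialEval p ℓ c K
    P = fromℤ (+ p ^ (ℓ ℕ.* suc K))

  partialEval≡c₀+Σ : ∀ p ℓ c K →
                     partialEval p ℓ c K ≡ c 0 + Σ1 K (λ k → fromℤ (+ p ^ (ℓ ℕ.* k)) * c k)
  partialEval≡c₀+Σ p ℓ c K = begin
    partialEval p ℓ c K                            ≡⟨ Σ≤-split K (λ k → c k * P k) ⟩
    partialEval p ℓ c 0 + Σ1 K (λ k → c k * P k)   ≡⟨ cong₂ _+_ (partialEval-0 p ℓ c) (Σ1-cong K commute) ⟩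
    c 0 + Σ1 K (λ k → P k * c k)                   ∎
    where
    open ≡-Reasoning
    P : ℕ → ℚ
    P k = fromℤ (+ p ^ (ℓ ℕ.* k))
    commute : ∀ k → c (suc k) * P (suc k) ≡ P (suc k) * c (suc k)
    commute k = ℚP.*-comm (c (suc k)) (P (suc k))

  partialEval-Tₙ≡tₙ : ∀ p ℓ e n → partialEval p ℓ (Tcoef e +[1+ n ]) (suc (suc n)) ≡ tval p ℓ e +[1+ n ]
  partialEval-Tₙ≡tₙ p ℓ e n = begin
    partialEval p ℓ (T₊ e (suc n)) (suc (suc n))
      ≡⟨ partialEval-vanishing p ℓ (T₊ e (suc n)) (suc n) (coefT-suc-self e (suc n)) ⟩
    partialEval p ℓ (T₊ e (suc n)) (suc n)
      ≡⟨ partialEval≡c₀+Σ p ℓ (T₊ e (suc n)) (suc n) ⟩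
    1ℚ + Σ1 (suc n) (λ k → fromℤ (+ p ^ (ℓ ℕ.* k)) * T₊ e (suc n) k)
      ≡⟨ cong (_+_ 1ℚ) (Σ1-cong (suc n) (λ _ → refl)) ⟩
    tval p ℓ e +[1+ n ]
      ∎
    where open ≡-Reasoning

  partialEval-T₀≡t₀ : ∀ p ℓ e → partialEval p ℓ (Tcoef e (+ 0)) 1 ≡ tval p ℓ e (+ 0)
  partialEval-T₀≡t₀ p ℓ e =
    trans (partialEval-vanishing p ℓ (Tcoef e (+ 0)) 0 (E·T₁-coef₁≡0 e))
          (partialEval-0 p ℓ (Tcoef e (+ 0)))

  partialEval-T₋₁≡t₋₁ : ∀ p ℓ e → partialEval p ℓ (Tcoef e -[1+ 0 ]) 0 ≡ tval p ℓ e -[1+ 0 ]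
  partialEval-T₋₁≡t₋₁ p ℓ e = partialEval-0 p ℓ (Tcoef e -[1+ 0 ])

open import Data.Nat using (ℕ; _≤_; _^_; _*_)
open import Data.Nat.Primality using (Prime)
open import Data.Integer using (ℤ; -[1+_]; ∣_∣; _+_; +_)
open import Data.Product using (∃)
open import Data.Nat using (suc)
open import Data.Nat.Properties using (+-comm)
open import Data.Integer using (+[1+_]; -≤-)
open import Relation.Binary.PropositionalEquality using (refl; cong; sym)

lemma4p6 : (p ℓ : ℕ) → Prime p → 1 ≤ ℓ → (e : ℕ → ℤ) → (ν : ℤ) → -[1+ 0 ] Data.Integer.≤ ν →
    ∃ λ K₀ → (K : ℕ) → K₀ ≤ K →
      partialEval p ℓ (Tcoef e ν) K ≡ tval p ℓ e ν [modℤ p ^ (ℓ * ∣ ν + + 2 ∣) ]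
lemma4p6 p ℓ _ _ e +[1+ n ] _ =
  eventually-≡-modℤ p ℓ (Tcoef-integral e +[1+ n ]) (partialEval-Tₙ≡tₙ p ℓ e n) (cong suc (sym (+-comm n 2)))
lemma4p6 p ℓ _ _ e (+ 0) _ = eventually-≡-modℤ p ℓ (Tcoef-integral e (+ 0)) (partialEval-T₀≡t₀ p ℓ e) refl
lemma4p6 p ℓ _ _ e -[1+ 0 ] _ = eventually-≡-modℤ p ℓ (Tcoef-integral e -[1+ 0 ]) (partialEval-T₋₁≡t₋₁ p ℓ e) refl
lemma4p6 p ℓ _ _ e -[1+ suc _ ] (-≤- ())
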